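{- Let $q$ be a prime power and let $\gamma$ be a real number with $\frac{4}{q}<\gamma\le 1$. Suppose $P\subseteq\mathbb F_q^2$ satisfies $T(P)\le \frac{\gamma q^2}{6}$. Then $|P|\le (1+\gamma)q$.
   Context: $\mathbb F_q$ is the finite field with $q$ elements. For $P\subseteq\mathbb F_q^2$, $T(P)$ denotes the number of $3$-element subsets of $P$ whose three points lie on a common line of $\mathbb F_q^2$.
   Formalization: The parameter γ ranges over the rationals in place of the reals. -}

module Defs where

open import Data.Nat as ℕ using (ℕ; NonZero)
open import Data.Fin as Fin using (Fin)
open import Data.Fin.Properties using (_≟_)
open import Data.List using (List; []; _∷_; map; _++_; length; allFin)
open import Data.Bool.ListAction using (any)
open import Data.Bool using (Bool; true; false; _∧_; not)
open import Data.Product using (_×_; _,_; Σ; ∃)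
open import Relation.Binary.PropositionalEquality using (_≡_)
open import Relation.Nullary using (¬_; does)
open import Relation.Nullary.Decidable using (⌊_⌋)
open import Algebra.Structures using (IsCommutativeRing)

-- A field structure on the finite set Fin q (so the field has exactly q elements),
-- with propositional equality.  Every finite field with q elements is isomorphic
-- to such a structure, and such a structure exists iff q is a prime power.
record FieldOn (q : ℕ) : Set where
  field
    _+_ _*_ : Fin q → Fin q → Fin q
    -_      : Fin q → Fin q
    0# 1#   : Fin q
    isCommutativeRing : IsCommutativeRing _≡_ _+_ _*_ -_ 0# 1#
    0≢1     : ¬ (0# ≡ 1#)
    _⁻¹     : Fin q → Fin q
    inverse : ∀ x → ¬ (x ≡ 0#) → (x * (x ⁻¹)) ≡ 1#

module _ {q : ℕ} (F : FieldOn q) where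
  open FieldOn F

  Point : Set
  Point = Fin q × Fin q

  onLine : Fin q → Fin q → Fin q → Point → Bool
  onLine a b c (x , y) = ⌊ ((a * x) + (b * y)) ≟ c ⌋

  isLineCoeff : Fin q → Fin q → Bool
  isLineCoeff a b = not (⌊ a ≟ 0# ⌋ ∧ ⌊ b ≟ 0# ⌋)

  collinear : Point → Point → Point → Bool
  collinear p₁ p₂ p₃ =
    any (λ a → any (λ b → any (λ c →
          isLineCoeff a b ∧ onLine a b c p₁ ∧ onLine a b c p₂ ∧ onLine a b c p₃)
        (allFin q)) (allFin q)) (allFin q)

-- all 3-element sub-lists (3-subsets when the list has distinct entries)
pairs : {A : Set} → List A → List (A × A)
pairs []       = []
pairs (x ∷ xs) = map (λ y → (x , y)) xs ++ pairs xs

triples : {A : Set} → List A → List (A × A × A)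
triples []       = []
triples (x ∷ xs) = map (λ yz → (x , yz)) (pairs xs) ++ triples xs

count : {A : Set} → (A → Bool) → List A → ℕ
count f []       = 0
count f (x ∷ xs) with f x
... | true  = ℕ.suc (count f xs)
... | false = count f xs

T : {q : ℕ} (F : FieldOn q) → List (Point F) → ℕ
T F P = count (λ { (a , b , c) → collinear F a b c }) (triples P)

module Submission where

-- Seen from a point p of P, the other points of P fall into the q + 1 directions of
-- lines through p, so by pigeonhole at least |P| − (q + 2) pairs of them lie on a
-- common line through p, each giving a collinear triple containing p. Summing over p
-- counts every collinear triple at most three times: |P|² ≤ 3 T(P) + |P| (q + 2).
-- Together with 6 T(P) ≤ γ q² and γ q > 4 this forces |P| ≤ (1 + γ) q.

open import Defs
open import Data.Bool using (Bool; true; false; _∧_; _∨_; if_then_else_)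
open import Data.Bool.ListAction using (any)
open import Data.Fin using (Fin)
open import Data.Fin.Properties using (_≟_)
open import Data.List using (List; []; _∷_; _++_; map; length; allFin)
open import Data.Nat using (ℕ; NonZero)
open import Data.Nat.ListAction using (sum)
open import Data.Product using (_×_; _,_; ∃; proj₁; proj₂)
open import Relation.Binary.PropositionalEquality
open import Relation.Nullary using (¬_; Dec; yes; no; contradiction)
open import Relation.Nullary.Decidable using (⌊_⌋; dec-true; dec-false; isYes≗does)

⌊⌋-true : {P : Set} (p? : Dec P) → P → ⌊ p? ⌋ ≡ true
⌊⌋-true p? p = trans (isYes≗does p?) (dec-true p? p)

⌊⌋-false : {P : Set} (p? : Dec P) → ¬ P → ⌊ p? ⌋ ≡ false
⌊⌋-false p? ¬p = trans (isYes≗does p?) (dec-false p? ¬p)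

⌊⌋-toWitness : {P : Set} (p? : Dec P) → ⌊ p? ⌋ ≡ true → P
⌊⌋-toWitness (yes p) _ = p

module Counting where

  open import Data.Bool.Properties using (∨-zeroʳ)
  open import Data.List.Membership.Propositional using (_∈_)
  open import Data.List.Membership.Propositional.Properties using (∈-allFin)
  open import Data.List.Properties using (length-tabulate)
  open import Data.List.Relation.Unary.All using (All; []; _∷_)
  open import Data.List.Relation.Unary.Any using (here; there)
  open import Data.Nat using (suc; _+_; _*_; _≤_; z≤n; s≤s)
  open import Data.Nat.Properties hiding (_≟_)
  open import Data.Nat.Tactic.RingSolver using (solve-∀)
  open import Algebra.Properties.CommutativeSemigroup +-commutativeSemigroup using (interchange; x∙yz≈y∙xz)
  open import Function using (_∘_)

  private variable
    A B : Set

  count-∷ : (f : A → Bool) (x : A) (xs : List A) →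
            count f (x ∷ xs) ≡ (if f x then 1 else 0) + count f xs
  count-∷ f x xs with f x
  ... | true  = refl
  ... | false = refl

  count-++ : (f : A → Bool) (xs ys : List A) → count f (xs ++ ys) ≡ count f xs + count f ys
  count-++ f []       ys = refl
  count-++ f (x ∷ xs) ys with f x
  ... | true  = cong suc (count-++ f xs ys)
  ... | false = count-++ f xs ys

  count-map : (f : B → Bool) (g : A → B) (xs : List A) → count f (map g xs) ≡ count (f ∘ g) xs
  count-map f g []       = refl
  count-map f g (x ∷ xs) with f (g x)
  ... | true  = cong suc (count-map f g xs)
  ... | false = count-map f g xs

  count-mono : {f g : A → Bool} → (∀ a → f a ≡ true → g a ≡ true) →
               (xs : List A) → count f xs ≤ count g xs
  count-mono f⇒g [] = z≤n
  count-mono {f = f} {g} f⇒g (x ∷ xs) with f x in fx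
  ... | true rewrite f⇒g x fx = s≤s (count-mono f⇒g xs)
  ... | false with g x
  ...   | true  = m≤n⇒m≤1+n (count-mono f⇒g xs)
  ...   | false = count-mono f⇒g xs

  count-none : {f : A → Bool} {xs : List A} → All (λ a → f a ≡ false) xs → count f xs ≡ 0
  count-none [] = refl
  count-none (fx ∷ fxs) rewrite fx = count-none fxs

  count≤length : (f : A → Bool) (xs : List A) → count f xs ≤ length xs
  count≤length f []       = z≤n
  count≤length f (x ∷ xs) with f x
  ... | true  = s≤s (count≤length f xs)
  ... | false = m≤n⇒m≤1+n (count≤length f xs)

  count-∨ : {f g : A → Bool} → (∀ a → f a ≡ true → g a ≡ false) →
            (xs : List A) → count (λ a → f a ∨ g a) xs ≡ count f xs + count g xs
  count-∨ disjoint [] = refl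
  count-∨ {f = f} {g} disjoint (x ∷ xs) with f x in fx
  ... | true rewrite disjoint x fx = cong suc (count-∨ disjoint xs)
  ... | false with g x
  ...   | true  = trans (cong suc (count-∨ disjoint xs)) (sym (+-suc (count f xs) (count g xs)))
  ...   | false = count-∨ disjoint xs

  any-∈ : (f : A → Bool) {x : A} {xs : List A} → x ∈ xs → f x ≡ true → any f xs ≡ true
  any-∈ f (here refl) fx rewrite fx = refl
  any-∈ f {xs = y ∷ _} (there x∈xs) fx rewrite any-∈ f x∈xs fx = ∨-zeroʳ (f y)

  any⇒1≤count : (f : A → Bool) (xs : List A) → any f xs ≡ true → 1 ≤ count f xs
  any⇒1≤count f (x ∷ xs) any-f with f x
  ... | true  = s≤s z≤n
  ... | false = any⇒1≤count f xs any-f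

  count-pairs-∷ : (g : A × A → Bool) (x : A) (xs : List A) →
                  count g (pairs (x ∷ xs)) ≡ count (λ y → g (x , y)) xs + count g (pairs xs)
  count-pairs-∷ g x xs =
    trans (count-++ g (map (x ,_) xs) (pairs xs)) (cong (_+ count g (pairs xs)) (count-map g (x ,_) xs))

  sum-map-+ : (f g : A → ℕ) (xs : List A) →
              sum (map (λ a → f a + g a) xs) ≡ sum (map f xs) + sum (map g xs)
  sum-map-+ f g []       = refl
  sum-map-+ f g (x ∷ xs) rewrite sum-map-+ f g xs =
    interchange (f x) (g x) (sum (map f xs)) (sum (map g xs))

  sum-map-mono : {f g : A → ℕ} → (∀ a → f a ≤ g a) → (xs : List A) → sum (map f xs) ≤ sum (map g xs)
  sum-map-mono f≤g []       = z≤n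
  sum-map-mono f≤g (x ∷ xs) = +-mono-≤ (f≤g x) (sum-map-mono f≤g xs)

  sum-map-const : (c : ℕ) (xs : List A) → sum (map (λ _ → c) xs) ≡ length xs * c
  sum-map-const c []       = refl
  sum-map-const c (x ∷ xs) = cong (c +_) (sum-map-const c xs)

  sum-count-∷ : (h : A → A → Bool) (w : A) (ws ys : List A) →
                sum (map (λ y → count (h y) (w ∷ ws)) ys) ≡
                  count (λ y → h y w) ys + sum (map (λ y → count (h y) ws) ys)
  sum-count-∷ h w ws []       = refl
  sum-count-∷ h w ws (y ∷ ys) rewrite sum-count-∷ h w ws ys with h y w
  ... | true  = cong suc (x∙yz≈y∙xz (count (h y) ws) (count (λ y → h y w) ys) _)
  ... | false = x∙yz≈y∙xz (count (h y) ws) (count (λ y → h y w) ys) _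

  sum-count≡pairs : (h : A → A → Bool) (xs : List A) →
    sum (map (λ y → count (h y) xs) xs) ≡
      count (λ { (y , z) → h y z }) (pairs xs) + count (λ { (y , z) → h z y }) (pairs xs)
        + count (λ y → h y y) xs
  sum-count≡pairs h []       = refl
  sum-count≡pairs h (w ∷ ws) = begin
    count (h w) (w ∷ ws) + sum (map (λ y → count (h y) (w ∷ ws)) ws)
      ≡⟨ cong₂ _+_ (count-∷ (h w) w ws) (sum-count-∷ h w ws ws) ⟩
    (b + c₁) + (c₂ + sum (map (λ y → count (h y) ws) ws))
      ≡⟨ cong (λ s → (b + c₁) + (c₂ + s)) (sum-count≡pairs h ws) ⟩
    (b + c₁) + (c₂ + ((p₁ + p₂) + d))
      ≡⟨ rearrange b c₁ c₂ p₁ p₂ d ⟩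
    (c₁ + p₁) + (c₂ + p₂) + (b + d)
      ≡⟨ sym (cong₂ _+_ (cong₂ _+_ (count-pairs-∷ H w ws) (count-pairs-∷ H′ w ws))
                        (count-∷ (λ y → h y y) w ws)) ⟩
    count H (pairs (w ∷ ws)) + count H′ (pairs (w ∷ ws)) + count (λ y → h y y) (w ∷ ws) ∎
    where
    open ≡-Reasoning
    H H′ : _ × _ → Bool
    H  (y , z) = h y z
    H′ (y , z) = h z y
    b  = if h w w then 1 else 0
    c₁ = count (h w) ws
    c₂ = count (λ y → h y w) ws
    p₁ = count H (pairs ws)
    p₂ = count H′ (pairs ws)
    d  = count (λ y → h y y) ws
    rearrange : ∀ b c₁ c₂ p₁ p₂ d → (b + c₁) + (c₂ + ((p₁ + p₂) + d)) ≡ (c₁ + p₁) + (c₂ + p₂) + (b + d)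
    rearrange = solve-∀

  module Pigeonhole {k : ℕ} (f : A → Fin k) where

    collisions : List A → ℕ
    collisions L = count (λ { (y , z) → ⌊ f y ≟ f z ⌋ }) (pairs L)

    hits : List A → Fin k → Bool
    hits L c = any (λ z → ⌊ c ≟ f z ⌋) L

    used : List A → ℕ
    used L = count (hits L) (allFin k)

    used≤k : ∀ L → used L ≤ k
    used≤k L = ≤-trans (count≤length (hits L) (allFin k)) (≤-reflexive (length-tabulate (λ c → c)))

    collisions-∷ : ∀ x xs → collisions (x ∷ xs) ≡ count (λ z → ⌊ f x ≟ f z ⌋) xs + collisions xs
    collisions-∷ x xs = count-pairs-∷ _ x xs

    collisions-mono : ∀ x xs → collisions xs ≤ collisions (x ∷ xs)
    collisions-mono x xs = ≤-trans (m≤n+m _ _) (≤-reflexive (sym (collisions-∷ x xs)))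

    collisions-old : ∀ x xs → hits xs (f x) ≡ true → suc (collisions xs) ≤ collisions (x ∷ xs)
    collisions-old x xs old =
      ≤-trans (+-monoˡ-≤ (collisions xs) (any⇒1≤count _ xs old)) (≤-reflexive (sym (collisions-∷ x xs)))

    used-mono : ∀ x xs → used xs ≤ used (x ∷ xs)
    used-mono x xs = count-mono (λ c h → trans (cong (⌊ c ≟ f x ⌋ ∨_) h) (∨-zeroʳ _)) (allFin k)

    used-new : ∀ x xs → hits xs (f x) ≡ false → suc (used xs) ≤ used (x ∷ xs)
    used-new x xs new = begin
      suc (used xs)                                              ≤⟨ +-monoˡ-≤ (used xs) fx-counted ⟩
      count (λ c → ⌊ c ≟ f x ⌋) (allFin k) + used xs             ≡⟨ sym (count-∨ disjoint (allFin k)) ⟩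
      used (x ∷ xs)                                              ∎
      where
      open ≤-Reasoning
      fx-counted : 1 ≤ count (λ c → ⌊ c ≟ f x ⌋) (allFin k)
      fx-counted = any⇒1≤count _ (allFin k) (any-∈ _ (∈-allFin (f x)) (⌊⌋-true (f x ≟ f x) refl))
      disjoint : ∀ c → ⌊ c ≟ f x ⌋ ≡ true → hits xs c ≡ false
      disjoint c c≡fx with c ≟ f x
      ... | yes refl = new

    length≤collisions+used : ∀ L → length L ≤ collisions L + used L
    length≤collisions+used []       = z≤n
    length≤collisions+used (x ∷ xs) with hits xs (f x) in fx∈xs
    ... | true  = ≤-trans (s≤s (length≤collisions+used xs))
                          (+-mono-≤ (collisions-old x xs fx∈xs) (used-mono x xs))
    ... | false = ≤-trans (s≤s (length≤collisions+used xs))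
                    (≤-trans (≤-reflexive (sym (+-suc _ _)))
                             (+-mono-≤ (collisions-mono x xs) (used-new x xs fx∈xs)))

    length≤collisions+k : ∀ L → length L ≤ collisions L + k
    length≤collisions+k L = ≤-trans (length≤collisions+used L) (+-monoʳ-≤ (collisions L) (used≤k L))

module Directions {q : ℕ} (F : FieldOn q) where

  open FieldOn F
  open Counting using (any-∈)
  open import Algebra.Bundles using (CommutativeRing)
  open import Data.Fin using (zero; suc)
  open import Data.List.Membership.Propositional.Properties using (∈-allFin)
  open import Data.Product.Properties using (≡-dec)
  import Data.Nat as ℕ

  private
    commutativeRing : CommutativeRing _ _
    commutativeRing = record { isCommutativeRing = isCommutativeRing }

  open CommutativeRing commutativeRing
    using (_-_; +-identityˡ; +-identityʳ; -‿inverseʳ; zeroˡ; zeroʳ; *-identityʳ; *-assoc; *-comm;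
           distribˡ; +-group; +-commutativeSemigroup; ring)
  open import Algebra.Properties.Group +-group using (//-rightDividesˡ)
  open import Algebra.Properties.CommutativeSemigroup +-commutativeSemigroup using (interchange)
  open import Algebra.Properties.Ring ring using (-1*x≈-x)

  1≢0 : ¬ 1# ≡ 0#
  1≢0 1≡0 = 0≢1 (sym 1≡0)

  -1≢0 : ¬ - 1# ≡ 0#
  -1≢0 -1≡0 = 1≢0 (begin
    1#          ≡⟨ sym (+-identityʳ 1#) ⟩
    1# + 0#     ≡⟨ cong (1# +_) (sym -1≡0) ⟩
    1# + (- 1#) ≡⟨ -‿inverseʳ 1# ⟩
    0#          ∎)
    where open ≡-Reasoning

  isLineCoeff-nonzeroˡ : ∀ {a} b → ¬ a ≡ 0# → isLineCoeff F a b ≡ true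
  isLineCoeff-nonzeroˡ {a} b a≢0 with a ≟ 0#
  ... | yes a≡0 = contradiction a≡0 a≢0
  ... | no _    = refl

  isLineCoeff-nonzeroʳ : ∀ a {b} → ¬ b ≡ 0# → isLineCoeff F a b ≡ true
  isLineCoeff-nonzeroʳ a {b} b≢0 with a ≟ 0# | b ≟ 0#
  ... | _     | yes b≡0 = contradiction b≡0 b≢0
  ... | yes _ | no _    = refl
  ... | no _  | no _    = refl

  record Line : Set where
    field
      a b c         : Fin q
      nondegenerate : isLineCoeff F a b ≡ true

  infix 4 _∈ₗ_
  _∈ₗ_ : Point F → Line → Set
  p ∈ₗ ℓ = onLine F a b c p ≡ true
    where open Line ℓ

  collinear-intro : ∀ ℓ {u v w} → u ∈ₗ ℓ → v ∈ₗ ℓ → w ∈ₗ ℓ → collinear F u v w ≡ true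
  collinear-intro ℓ u∈ℓ v∈ℓ w∈ℓ =
    any-∈ _ (∈-allFin a) (any-∈ _ (∈-allFin b) (any-∈ _ (∈-allFin c)
      (cong₂ _∧_ nondegenerate (cong₂ _∧_ u∈ℓ (cong₂ _∧_ v∈ℓ w∈ℓ)))))
    where open Line ℓ

  lineThrough : Point F → (a b : Fin q) → isLineCoeff F a b ≡ true → Line
  lineThrough (x , y) a b nondegenerate =
    record { a = a ; b = b ; c = (a * x) + (b * y) ; nondegenerate = nondegenerate }

  onLine-self : ∀ a b x y → onLine F a b ((a * x) + (b * y)) (x , y) ≡ true
  onLine-self a b x y = ⌊⌋-true (_ ≟ _) refl

  onLine-displaced : ∀ a b {x y x′ y′} → (a * (x′ - x)) + (b * (y′ - y)) ≡ 0# →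
                     onLine F a b ((a * x) + (b * y)) (x′ , y′) ≡ true
  onLine-displaced a b {x} {y} {x′} {y′} e = ⌊⌋-true (_ ≟ _) (begin
    (a * x′) + (b * y′)
      ≡⟨ cong₂ (λ u v → (a * u) + (b * v)) (sym (//-rightDividesˡ x x′)) (sym (//-rightDividesˡ y y′)) ⟩
    (a * ((x′ - x) + x)) + (b * ((y′ - y) + y))
      ≡⟨ cong₂ _+_ (distribˡ a (x′ - x) x) (distribˡ b (y′ - y) y) ⟩
    ((a * (x′ - x)) + (a * x)) + ((b * (y′ - y)) + (b * y))
      ≡⟨ interchange (a * (x′ - x)) (a * x) (b * (y′ - y)) (b * y) ⟩
    ((a * (x′ - x)) + (b * (y′ - y))) + ((a * x) + (b * y))
      ≡⟨ cong (_+ ((a * x) + (b * y))) e ⟩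
    0# + ((a * x) + (b * y))
      ≡⟨ +-identityˡ _ ⟩
    (a * x) + (b * y) ∎)
    where open ≡-Reasoning

  Direction : Set
  Direction = Fin (2 ℕ.+ q)

  _≟ₚ_ : (p p′ : Point F) → Dec (p ≡ p′)
  _≟ₚ_ = ≡-dec _≟_ _≟_

  -- zero is reserved for z = p, suc zero is the vertical direction and suc (suc s) the slope s.
  dir : Point F → Point F → Direction
  dir p@(px , py) z@(zx , zy) with z ≟ₚ p | (zx - px) ≟ 0#
  ... | yes _ | _     = zero
  ... | no _  | yes _ = suc zero
  ... | no _  | no _  = suc (suc ((zy - py) * ((zx - px) ⁻¹)))

  coefficients : Direction → Fin q × Fin q
  coefficients (suc (suc s)) = s , - 1#
  coefficients _             = 1# , 0#

  coefficients-nondegenerate : ∀ k → isLineCoeff F (proj₁ (coefficients k)) (proj₂ (coefficients k)) ≡ true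
  coefficients-nondegenerate zero          = isLineCoeff-nonzeroˡ 0# 1≢0
  coefficients-nondegenerate (suc zero)    = isLineCoeff-nonzeroˡ 0# 1≢0
  coefficients-nondegenerate (suc (suc s)) = isLineCoeff-nonzeroʳ s -1≢0

  through : Point F → Direction → Line
  through p k = lineThrough p (proj₁ (coefficients k)) (proj₂ (coefficients k)) (coefficients-nondegenerate k)

  ∈-through : ∀ p k → p ∈ₗ through p k
  ∈-through (x , y) k = onLine-self _ _ x y

  ∈-through-dir : ∀ p z → z ∈ₗ through p (dir p z)
  ∈-through-dir p@(px , py) z@(zx , zy) with z ≟ₚ p | (zx - px) ≟ 0#
  ... | yes refl | _       = ∈-through p zero
  ... | no _     | yes δ≡0 = onLine-displaced 1# 0# (begin
    (1# * (zx - px)) + (0# * (zy - py))  ≡⟨ cong₂ _+_ (cong (1# *_) δ≡0) (zeroˡ (zy - py)) ⟩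
    (1# * 0#) + 0#                       ≡⟨ +-identityʳ (1# * 0#) ⟩
    1# * 0#                              ≡⟨ zeroʳ 1# ⟩
    0#                                   ∎)
    where open ≡-Reasoning
  ... | no _     | no δ≢0  = onLine-displaced s (- 1#) (begin
    (s * δ) + ((- 1#) * ε)   ≡⟨ cong₂ _+_ sδ≡ε (-1*x≈-x ε) ⟩
    ε + (- ε)                ≡⟨ -‿inverseʳ ε ⟩
    0#                       ∎)
    where
    open ≡-Reasoning
    δ = zx - px
    ε = zy - py
    s = ε * (δ ⁻¹)
    sδ≡ε : s * δ ≡ ε
    sδ≡ε = begin
      (ε * (δ ⁻¹)) * δ  ≡⟨ *-assoc ε (δ ⁻¹) δ ⟩
      ε * ((δ ⁻¹) * δ)  ≡⟨ cong (ε *_) (trans (*-comm (δ ⁻¹) δ) (inverse δ δ≢0)) ⟩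
      ε * 1#            ≡⟨ *-identityʳ ε ⟩
      ε                 ∎

  dir-self : ∀ p → dir p p ≡ zero
  dir-self p@(px , _) with p ≟ₚ p | (px - px) ≟ 0#
  ... | yes _  | _ = refl
  ... | no p≢p | _ = contradiction refl p≢p

  dir≡zero⇒≡ : ∀ p z → dir p z ≡ zero → z ≡ p
  dir≡zero⇒≡ p@(px , _) z@(zx , _) with z ≟ₚ p | (zx - px) ≟ 0#
  ... | yes z≡p | _     = λ _ → z≡p
  ... | no _    | yes _ = λ ()
  ... | no _    | no _  = λ ()

  common-line : ∀ p y z → dir p y ≡ dir p z → ∃ λ ℓ → p ∈ₗ ℓ × y ∈ₗ ℓ × z ∈ₗ ℓ
  common-line p y z same =
    through p (dir p y) , ∈-through p (dir p y) , ∈-through-dir p y ,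
    subst (λ k → z ∈ₗ through p k) (sym same) (∈-through-dir p z)

  dir≢dir-self : ∀ {p z} → z ≢ p → dir p z ≢ dir p p
  dir≢dir-self {p} {z} z≢p same = z≢p (dir≡zero⇒≡ p z (trans same (dir-self p)))

module Incidence {q : ℕ} (F : FieldOn q) where

  open Counting
  open Directions F using (dir; dir≢dir-self; common-line; collinear-intro)
  open import Data.List.Properties using (map-cong)
  open import Data.List.Relation.Unary.All as All using (All)
  open import Data.List.Relation.Unary.AllPairs using (_∷_; [])
  open import Data.List.Relation.Unary.Unique.Propositional using (Unique)
  open import Data.Nat using (_+_; _*_; _≤_; z≤n)
  open import Data.Nat.Properties hiding (_≟_)
  open import Data.Nat.Tactic.RingSolver using (solve-∀)

  collinearPairs : Point F → List (Point F) → ℕ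
  collinearPairs x L = count (λ { (y , z) → collinear F x y z }) (pairs L)

  sameDirectionPairs : Point F → List (Point F) → ℕ
  sameDirectionPairs p = Pigeonhole.collisions (dir p)

  sameDirectionAs : Point F → Point F → List (Point F) → ℕ
  sameDirectionAs p x xs = count (λ z → ⌊ dir p x ≟ dir p z ⌋) xs

  T-∷ : ∀ x xs → T F (x ∷ xs) ≡ collinearPairs x xs + T F xs
  T-∷ x xs = trans (count-++ _ (map (x ,_) (pairs xs)) (triples xs))
                   (cong (_+ T F xs) (count-map _ (x ,_) (pairs xs)))

  sameDirectionPairs-head : ∀ {x xs} → All (x ≢_) xs → sameDirectionPairs x (x ∷ xs) ≤ collinearPairs x xs
  sameDirectionPairs-head {x} {xs} x≢xs = begin
    sameDirectionPairs x (x ∷ xs)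
      ≡⟨ Pigeonhole.collisions-∷ (dir x) x xs ⟩
    sameDirectionAs x x xs + sameDirectionPairs x xs
      ≡⟨ cong (_+ sameDirectionPairs x xs) no-self ⟩
    sameDirectionPairs x xs
      ≤⟨ count-mono seen-from-x (pairs xs) ⟩
    collinearPairs x xs ∎
    where
    open ≤-Reasoning
    no-self : sameDirectionAs x x xs ≡ 0
    no-self = count-none (All.map (λ x≢z → ⌊⌋-false _ (≢-sym (dir≢dir-self (≢-sym x≢z)))) x≢xs)
    seen-from-x : ∀ yz → ⌊ dir x (proj₁ yz) ≟ dir x (proj₂ yz) ⌋ ≡ true →
                  collinear F x (proj₁ yz) (proj₂ yz) ≡ true
    seen-from-x (y , z) same = let ℓ , x∈ℓ , y∈ℓ , z∈ℓ = common-line x y z (⌊⌋-toWitness _ same)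
                               in collinear-intro ℓ x∈ℓ y∈ℓ z∈ℓ

  sum-sameDirectionAs≤2*collinearPairs : ∀ {x xs} → All (x ≢_) xs →
    sum (map (λ p → sameDirectionAs p x xs) xs) ≤ 2 * collinearPairs x xs
  sum-sameDirectionAs≤2*collinearPairs {x} {xs} x≢xs = begin
    sum (map (λ p → count (h p) xs) xs)
      ≡⟨ sum-count≡pairs h xs ⟩
    count h₁ (pairs xs) + count h₂ (pairs xs) + count (λ y → h y y) xs
      ≡⟨ cong (count h₁ (pairs xs) + count h₂ (pairs xs) +_) no-diagonal ⟩
    count h₁ (pairs xs) + count h₂ (pairs xs) + 0
      ≤⟨ +-monoˡ-≤ 0 (+-mono-≤ (count-mono seen-from-y (pairs xs)) (count-mono seen-from-z (pairs xs))) ⟩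
    collinearPairs x xs + collinearPairs x xs + 0
      ≡⟨ trans (+-identityʳ _) (cong (collinearPairs x xs +_) (sym (+-identityʳ _))) ⟩
    2 * collinearPairs x xs ∎
    where
    open ≤-Reasoning
    h : Point F → Point F → Bool
    h p z = ⌊ dir p x ≟ dir p z ⌋
    no-diagonal : count (λ y → h y y) xs ≡ 0
    no-diagonal = count-none (All.map (λ x≢y → ⌊⌋-false _ (dir≢dir-self x≢y)) x≢xs)
    h₁ h₂ : Point F × Point F → Bool
    h₁ (y , z) = h y z
    h₂ (y , z) = h z y
    seen-from-y : ∀ yz → h₁ yz ≡ true → collinear F x (proj₁ yz) (proj₂ yz) ≡ true
    seen-from-y (y , z) same = let ℓ , y∈ℓ , x∈ℓ , z∈ℓ = common-line y x z (⌊⌋-toWitness _ same)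
                               in collinear-intro ℓ x∈ℓ y∈ℓ z∈ℓ
    seen-from-z : ∀ yz → h₂ yz ≡ true → collinear F x (proj₁ yz) (proj₂ yz) ≡ true
    seen-from-z (y , z) same = let ℓ , z∈ℓ , x∈ℓ , y∈ℓ = common-line z x y (⌊⌋-toWitness _ same)
                               in collinear-intro ℓ x∈ℓ y∈ℓ z∈ℓ

  sum-sameDirectionPairs≤3T : ∀ L → Unique L → sum (map (λ p → sameDirectionPairs p L) L) ≤ 3 * T F L
  sum-sameDirectionPairs≤3T []       []                 = z≤n
  sum-sameDirectionPairs≤3T (x ∷ xs) (x≢xs ∷ unique-xs) = begin
    sameDirectionPairs x (x ∷ xs) + sum (map (λ p → sameDirectionPairs p (x ∷ xs)) xs)
      ≡⟨ cong (sameDirectionPairs x (x ∷ xs) +_) (trans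
           (cong sum (map-cong (λ p → Pigeonhole.collisions-∷ (dir p) x xs) xs))
           (sum-map-+ (λ p → sameDirectionAs p x xs) (λ p → sameDirectionPairs p xs) xs)) ⟩
    sameDirectionPairs x (x ∷ xs)
      + (sum (map (λ p → sameDirectionAs p x xs) xs) + sum (map (λ p → sameDirectionPairs p xs) xs))
      ≤⟨ +-mono-≤ (sameDirectionPairs-head x≢xs)
                  (+-mono-≤ (sum-sameDirectionAs≤2*collinearPairs x≢xs) (sum-sameDirectionPairs≤3T xs unique-xs)) ⟩
    collinearPairs x xs + (2 * collinearPairs x xs + 3 * T F xs)
      ≡⟨ a+[2a+3t]≡3[a+t] (collinearPairs x xs) (T F xs) ⟩
    3 * (collinearPairs x xs + T F xs)
      ≡⟨ cong (3 *_) (sym (T-∷ x xs)) ⟩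
    3 * T F (x ∷ xs) ∎
    where
    open ≤-Reasoning
    a+[2a+3t]≡3[a+t] : ∀ a t → a + (2 * a + 3 * t) ≡ 3 * (a + t)
    a+[2a+3t]≡3[a+t] = solve-∀

  length²≤3T+length*[2+q] : ∀ L → Unique L → length L * length L ≤ 3 * T F L + length L * (2 + q)
  length²≤3T+length*[2+q] L unique = begin
    length L * length L
      ≡⟨ sym (sum-map-const (length L) L) ⟩
    sum (map (λ _ → length L) L)
      ≤⟨ sum-map-mono (λ p → Pigeonhole.length≤collisions+k (dir p) L) L ⟩
    sum (map (λ p → sameDirectionPairs p L + (2 + q)) L)
      ≡⟨ sum-map-+ (λ p → sameDirectionPairs p L) (λ _ → 2 + q) L ⟩
    sum (map (λ p → sameDirectionPairs p L) L) + sum (map (λ _ → 2 + q) L)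
      ≤⟨ +-mono-≤ (sum-sameDirectionPairs≤3T L unique) (≤-reflexive (sum-map-const (2 + q) L)) ⟩
    3 * T F L + length L * (2 + q) ∎
    where open ≤-Reasoning

module Arithmetic where

  open import Data.List using ([]; _∷_)
  open import Data.Nat
  open import Data.Nat.Properties
  open import Data.Nat.Tactic.RingSolver using (solve)

  -- If n b > (a + b) q then q < n, and doubling n² ≤ 3 t + n (2 + q) against 6 b t ≤ a q²
  -- leaves n (a q + 2) ≤ n (4 b), contradicting 4 b < a q.
  length-bound : ∀ q n t a b → 4 * b < a * q → 6 * b * t ≤ a * (q * q) →
                 n * n ≤ 3 * t + n * (2 + q) → n * b ≤ (b + a) * q
  length-bound q n t a b 4b<aq 6bt≤aq² n²≤ = ≮⇒≥ λ [b+a]q<nb → <⇒≱ 4b<aq (aq≤4b [b+a]q<nb)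
    where
    aq≤4b : (b + a) * q < n * b → a * q ≤ 4 * b
    aq≤4b [b+a]q<nb =
      ≤-trans (m≤m+n (a * q) 2)
        (*-cancelˡ-≤ n {{>-nonZero (≤-<-trans z≤n q<n)}}
          (+-cancelʳ-≤ (n * (a * q) + 2 * b * (n * q)) (n * (a * q + 2)) (n * (4 * b)) (begin
            n * (a * q + 2) + (n * (a * q) + 2 * b * (n * q))  ≡⟨ solve (n ∷ a ∷ q ∷ b ∷ []) ⟩
            2 * n * (1 + (b + a) * q)                          ≤⟨ *-monoʳ-≤ (2 * n) [b+a]q<nb ⟩
            2 * n * (n * b)                                    ≡⟨ solve (n ∷ b ∷ []) ⟩
            2 * b * (n * n)                                    ≤⟨ *-monoʳ-≤ (2 * b) n²≤ ⟩
            2 * b * (3 * t + n * (2 + q))                      ≡⟨ solve (b ∷ t ∷ n ∷ q ∷ []) ⟩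
            6 * b * t + (n * (4 * b) + 2 * b * (n * q))        ≤⟨ +-monoˡ-≤ _ 6bt≤aq² ⟩
            a * (q * q) + (n * (4 * b) + 2 * b * (n * q))      ≤⟨ +-monoˡ-≤ _ aq²≤naq ⟩
            n * (a * q) + (n * (4 * b) + 2 * b * (n * q))      ≡⟨ solve (n ∷ a ∷ q ∷ b ∷ []) ⟩
            n * (4 * b) + (n * (a * q) + 2 * b * (n * q))      ∎)))
      where
      open ≤-Reasoning
      q<n : q < n
      q<n = *-cancelʳ-< b q n (begin-strict
        q * b          ≡⟨ *-comm q b ⟩
        b * q          ≤⟨ m≤m+n (b * q) (a * q) ⟩
        b * q + a * q  ≡⟨ *-distribʳ-+ q b a ⟨
        (b + a) * q    <⟨ [b+a]q<nb ⟩
        n * b          ∎)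
      aq²≤naq : a * (q * q) ≤ n * (a * q)
      aq²≤naq = begin
        a * (q * q)  ≡⟨ solve (a ∷ q ∷ []) ⟩
        q * (a * q)  ≤⟨ *-monoˡ-≤ (a * q) (<⇒≤ q<n) ⟩
        n * (a * q)  ∎

module Rational where

  open import Data.Integer as ℤ using (+_; -[1+_])
  import Data.Integer.Properties as ℤ
  import Data.Integer.Tactic.RingSolver as ℤ-Solver
  open import Data.Nat as ℕ using (suc)
  open import Data.Nat.Coprimality using (Coprime)
  open import Data.Nat.Tactic.RingSolver using (solve-∀)
  open import Data.Rational using (ℚ; mkℚ; _/_; _<_; _≤_; _*_; _+_; 1ℚ; toℚᵘ)
  open import Data.Rational.Properties
    using (toℚᵘ-fromℚᵘ; toℚᵘ-mono-<; toℚᵘ-mono-≤; toℚᵘ-cancel-≤; toℚᵘ-homo-*; toℚᵘ-homo-+)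
  open import Data.Rational.Unnormalised as ℚᵘ using (mkℚᵘ; _≃_; *≤*)
  import Data.Rational.Unnormalised.Properties as ℚᵘ

  toℚᵘ-/ : ∀ n d → toℚᵘ (+ n / suc d) ≃ mkℚᵘ (+ n) d
  toℚᵘ-/ n d = toℚᵘ-fromℚᵘ (mkℚᵘ (+ n) d)

  positive/≮negative : ∀ m k {n d} .{c : Coprime (suc n) (suc d)} → ¬ (+ suc m / suc k < mkℚ -[1+ n ] d c)
  positive/≮negative m k h with ℚᵘ.drop-*<* (ℚᵘ.<-respˡ-≃ (toℚᵘ-/ (suc m) k) (toℚᵘ-mono-< h))
  ... | ()

  module Fraction (a d : ℕ) .(coprime : Coprime a (suc d)) where

    γ : ℚ
    γ = mkℚ (+ a) d coprime

    b : ℕ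
    b = suc d

    <γ⇒ : ∀ m k → + m / suc k < γ → m ℕ.* b ℕ.< a ℕ.* suc k
    <γ⇒ m k h = ℤ.drop‿+<+ (subst₂ ℤ._<_ (sym (ℤ.pos-* m b)) (sym (ℤ.pos-* a (suc k)))
      (ℚᵘ.drop-*<* (ℚᵘ.<-respˡ-≃ (toℚᵘ-/ m k) (toℚᵘ-mono-< h))))

    ≤γ*m/6⇒ : ∀ t m → + t / 1 ≤ γ * (+ m / 1) * (+ 1 / 6) → 6 ℕ.* b ℕ.* t ℕ.≤ a ℕ.* m
    ≤γ*m/6⇒ t m h = ℤ.drop‿+≤+ (subst₂ ℤ._≤_ lhs rhs
      (ℚᵘ.drop-*≤* (ℚᵘ.≤-respˡ-≃ (toℚᵘ-/ t 0) (ℚᵘ.≤-respʳ-≃ toℚᵘ-γm/6 (toℚᵘ-mono-≤ h)))))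
      where
      toℚᵘ-γm/6 : toℚᵘ (γ * (+ m / 1) * (+ 1 / 6)) ≃ mkℚᵘ (+ a) d ℚᵘ.* mkℚᵘ (+ m) 0 ℚᵘ.* mkℚᵘ (+ 1) 5
      toℚᵘ-γm/6 = ℚᵘ.≃-trans (toℚᵘ-homo-* (γ * (+ m / 1)) (+ 1 / 6))
               (ℚᵘ.*-cong (ℚᵘ.≃-trans (toℚᵘ-homo-* γ (+ m / 1)) (ℚᵘ.*-congˡ (toℚᵘ-/ m 0))) (toℚᵘ-/ 1 5))
      reorder : ∀ b t → t ℕ.* (b ℕ.* 1 ℕ.* 6) ≡ 6 ℕ.* b ℕ.* t
      reorder = solve-∀
      lhs : _ ≡ + (6 ℕ.* b ℕ.* t)
      lhs = trans (sym (ℤ.pos-* t _)) (cong +_ (reorder b t))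
      rhs : _ ≡ + (a ℕ.* m)
      rhs = trans (ℤ.*-identityʳ _) (trans (ℤ.*-identityʳ _) (sym (ℤ.pos-* a m)))

    ≤[1+γ]* : ∀ n m → n ℕ.* b ℕ.≤ (b ℕ.+ a) ℕ.* m → + n / 1 ≤ (1ℚ + γ) * (+ m / 1)
    ≤[1+γ]* n m h =
      toℚᵘ-cancel-≤ (ℚᵘ.≤-respˡ-≃ (ℚᵘ.≃-sym (toℚᵘ-/ n 0)) (ℚᵘ.≤-respʳ-≃ (ℚᵘ.≃-sym toℚᵘ-[1+γ]m)
        (*≤* (subst₂ ℤ._≤_ lhs rhs (ℤ.+≤+ h)))))
      where
      toℚᵘ-[1+γ]m : toℚᵘ ((1ℚ + γ) * (+ m / 1)) ≃ (mkℚᵘ (+ 1) 0 ℚᵘ.+ mkℚᵘ (+ a) d) ℚᵘ.* mkℚᵘ (+ m) 0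
      toℚᵘ-[1+γ]m =
        ℚᵘ.≃-trans (toℚᵘ-homo-* (1ℚ + γ) (+ m / 1)) (ℚᵘ.*-cong (toℚᵘ-homo-+ 1ℚ γ) (toℚᵘ-/ m 0))
      reorderℕ : ∀ n b → n ℕ.* b ≡ n ℕ.* (1 ℕ.* b ℕ.* 1)
      reorderℕ = solve-∀
      reorderℤ : ∀ B A M → (B ℤ.+ A) ℤ.* M ≡ ((ℤ.1ℤ ℤ.* B ℤ.+ A ℤ.* ℤ.1ℤ) ℤ.* M) ℤ.* ℤ.1ℤ
      reorderℤ = ℤ-Solver.solve-∀
      lhs : + (n ℕ.* b) ≡ _
      lhs = trans (cong +_ (reorderℕ n b)) (ℤ.pos-* n _)
      rhs : + ((b ℕ.+ a) ℕ.* m) ≡ _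
      rhs = trans (ℤ.pos-* (b ℕ.+ a) m) (trans (cong (ℤ._* + m) (ℤ.pos-+ b a)) (reorderℤ (+ b) (+ a) (+ m)))

open import Data.List.Relation.Unary.Unique.Propositional using (Unique)
open import Data.Integer using (+_; -[1+_])
open import Data.Rational using (ℚ; mkℚ; _/_; _<_; _≤_; _*_; _+_; 1ℚ)
open import Data.Nat using (suc)
open Rational using (positive/≮negative; module Fraction)

corollary1 : (q : ℕ) → .{{_ : NonZero q}} → (F : FieldOn q) → (γ : ℚ)
    → (+ 4 / q) < γ → γ ≤ 1ℚ
    → (P : List (Point F)) → Unique P
    → (+ T F P / 1) ≤ (γ * (+ (q Data.Nat.* q) / 1)) * (+ 1 / 6)
    → (+ length P / 1) ≤ (1ℚ + γ) * (+ q / 1)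
corollary1 (suc k) F (mkℚ -[1+ _ ] _ _) 4/q<γ _ _ _ _ = contradiction 4/q<γ (positive/≮negative 3 k)
corollary1 q@(suc k) F (mkℚ (+ a) d coprime) 4/q<γ _ P unique T≤γq²/6 =
  ≤[1+γ]* (length P) q (Arithmetic.length-bound q (length P) (T F P) a b
    (<γ⇒ 4 k 4/q<γ)
    (≤γ*m/6⇒ (T F P) (q Data.Nat.* q) T≤γq²/6)
    (Incidence.length²≤3T+length*[2+q] F P unique))
  where open Fraction a d coprime
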